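{- Let $(q_j)_{j\ge0}$ be integers with $q_0=1$ and $q_j\ge2$ for $j\ge1$. Every positive integer $n$ has a unique representation $n=\sum_{y\ge0}s_{n,y}\prod_{j=0}^{y}q_j$ with integers $0\le s_{n,y}\le q_{y+1}-1$, almost all zero; set $y_{n,\min}:=\min\{y: s_{n,y}\neq0\}$. Let $l$ be a positive integer and $t$ a non-negative integer. Then there exists a positive integer $x$ such that, writing $m=xl$, $$s_{m,y_{m,\min}}=1\quad\text{and}\quad s_{m,y}=0\ \text{ for every integer } y \text{ with } y_{m,\min}<y<y_{m,\min}+t.$$ -}

module Defs where

open import Data.Nat using (ℕ; zero; suc; _+_; _*_; _<_; _≤_)
open import Data.Product using (_×_; ∃-syntax)
open import Relation.Binary.PropositionalEquality using (_≡_)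

Qprod : (ℕ → ℕ) → ℕ → ℕ
Qprod q zero    = q 0
Qprod q (suc y) = Qprod q y * q (suc y)

sumUpTo : (ℕ → ℕ) → ℕ → ℕ
sumUpTo f zero    = 0
sumUpTo f (suc N) = sumUpTo f N + f N

IsRep : (ℕ → ℕ) → (ℕ → ℕ) → ℕ → Set
IsRep q s n =
  (∀ y → s y < q (suc y)) ×
  (∃[ N ] ((∀ y → N ≤ y → s y ≡ 0) × (n ≡ sumUpTo (λ y → s y * Qprod q y) N)))

module Submission where

-- Put c = t + 1 and let w = Qprod q be the place values of the
-- mixed radix system.  For a < b, the number  w(c·a) + w(c·(a+1)) + … + w(c·(b−1))
-- has the digit sequence that is 1 exactly at the positions c·a, c·(a+1), …,
-- c·(b−1) and 0 elsewhere (a "comb"); its lowest digit is a 1 at c·a and the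
-- next t positions carry 0.  It therefore suffices to find such a number that
-- is a positive multiple of l.  With S k = w 0 + w c + … + w (c·(k−1)) the
-- comb number above equals S b − S a, and by the pigeonhole principle two of
-- S 0, …, S l agree modulo l, which makes S b − S a divisible by l.

open import Defs
open import Data.Nat using (ℕ; suc; _*_; _<_; _≤_; _+_)
open import Data.Product using (_×_; ∃-syntax)
open import Relation.Binary.PropositionalEquality using (_≡_)

open import Data.Nat using (zero; z≤n; s≤s; z<s; _%_; _/_; _≟_; NonZero; >-nonZero; >-nonZero⁻¹)
open import Data.Nat.Properties
open import Data.Nat.DivMod using (m≡m%n+[m/n]*n; m%n<n)
open import Data.Nat.Divisibility using (_∣_; divides; quotient; quotient≢0; m∣n⇒n≡quotient*m; n∣m*n; ∣m+n∣m⇒∣n)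
open import Data.Fin using (Fin; toℕ; fromℕ<)
open import Data.Fin.Properties using (pigeonhole; toℕ-fromℕ<)
open import Data.Product using (_,_)
open import Data.Sum using (inj₁; inj₂)
open import Relation.Nullary using (yes; no; contradiction)
open import Relation.Binary.PropositionalEquality
  using (refl; sym; trans; cong; cong₂; subst; _≢_; ≢-sym; module ≡-Reasoning)
open import Algebra.Properties.CommutativeSemigroup +-commutativeSemigroup using (interchange)

open ≡-Reasoning

sumUpTo-cong : ∀ {f g} → (∀ y → f y ≡ g y) → ∀ N → sumUpTo f N ≡ sumUpTo g N
sumUpTo-cong f≗g zero    = refl
sumUpTo-cong f≗g (suc N) = cong₂ _+_ (sumUpTo-cong f≗g N) (f≗g N)

sumUpTo-+ : ∀ f g N → sumUpTo (λ y → f y + g y) N ≡ sumUpTo f N + sumUpTo g N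
sumUpTo-+ f g zero    = refl
sumUpTo-+ f g (suc N) =
  trans (cong (_+ (f N + g N)) (sumUpTo-+ f g N))
        (interchange (sumUpTo f N) (sumUpTo g N) (f N) (g N))

sumUpTo-zero : ∀ N → sumUpTo (λ _ → 0) N ≡ 0
sumUpTo-zero zero    = refl
sumUpTo-zero (suc N) = cong (_+ 0) (sumUpTo-zero N)

term≤sumUpTo : ∀ f {N y} → y < N → f y ≤ sumUpTo f N
term≤sumUpTo f {suc N} y<1+N with m<1+n⇒m<n∨m≡n y<1+N
... | inj₁ y<N  = ≤-trans (term≤sumUpTo f y<N) (m≤m+n _ _)
... | inj₂ refl = m≤n+m (f N) (sumUpTo f N)

δ : ℕ → ℕ → ℕ
δ p y with p ≟ y
... | yes _ = 1
... | no  _ = 0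

δ-diag : ∀ p → δ p p ≡ 1
δ-diag p with p ≟ p
... | yes _   = refl
... | no  p≢p = contradiction refl p≢p

δ-off : ∀ {p y} → p ≢ y → δ p y ≡ 0
δ-off {p} {y} p≢y with p ≟ y
... | yes p≡y = contradiction p≡y p≢y
... | no  _   = refl

sumUpTo-δ-outside : ∀ (w : ℕ → ℕ) p N → N ≤ p → sumUpTo (λ y → δ p y * w y) N ≡ 0
sumUpTo-δ-outside w p zero    _     = refl
sumUpTo-δ-outside w p (suc N) 1+N≤p =
  cong₂ _+_ (sumUpTo-δ-outside w p N (≤-trans (n≤1+n N) 1+N≤p))
            (cong (_* w N) (δ-off (>⇒≢ 1+N≤p)))

sumUpTo-δ : ∀ (w : ℕ → ℕ) p N → p < N → sumUpTo (λ y → δ p y * w y) N ≡ w p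
sumUpTo-δ w p (suc N) p<1+N with m<1+n⇒m<n∨m≡n p<1+N
... | inj₁ p<N  = begin
  sumUpTo (λ y → δ p y * w y) N + δ p N * w N
    ≡⟨ cong₂ _+_ (sumUpTo-δ w p N p<N) (cong (_* w N) (δ-off (<⇒≢ p<N))) ⟩
  w p + 0
    ≡⟨ +-identityʳ (w p) ⟩
  w p ∎
... | inj₂ refl = begin
  sumUpTo (λ y → δ p y * w y) p + δ p p * w p
    ≡⟨ cong₂ _+_ (sumUpTo-δ-outside w p p ≤-refl) (cong (_* w p) (δ-diag p)) ⟩
  w p + 0
    ≡⟨ +-identityʳ (w p) ⟩
  w p ∎

module Comb (c : ℕ) .{{_ : NonZero c}} where

  comb : ℕ → ℕ → ℕ → ℕ
  comb a zero    y = 0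
  comb a (suc n) y = δ (c * a) y + comb (suc a) n y

  comb-below : ∀ a n y → y < c * a → comb a n y ≡ 0
  comb-below a zero    y y<ca = refl
  comb-below a (suc n) y y<ca =
    cong₂ _+_ (δ-off (>⇒≢ y<ca))
              (comb-below (suc a) n y (<-trans y<ca (*-monoʳ-< c (n<1+n a))))

  comb-above : ∀ a n y → c * (a + n) ≤ y → comb a n y ≡ 0
  comb-above a zero    y _  = refl
  comb-above a (suc n) y le =
    cong₂ _+_ (δ-off (<⇒≢ (<-≤-trans (*-monoʳ-< c (m<m+n a z<s)) le)))
              (comb-above (suc a) n y (subst (λ u → c * u ≤ y) (+-suc a n) le))

  comb-first : ∀ a n → comb a (suc n) (c * a) ≡ 1
  comb-first a n =
    cong₂ _+_ (δ-diag (c * a)) (comb-below (suc a) n (c * a) (*-monoʳ-< c (n<1+n a)))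

  comb-gap : ∀ a n y → c * a < y → y < c * a + c → comb a (suc n) y ≡ 0
  comb-gap a n y ca<y y<ca+c =
    cong₂ _+_ (δ-off (<⇒≢ ca<y)) (comb-below (suc a) n y y<c[1+a])
    where
    y<c[1+a] : y < c * suc a
    y<c[1+a] = subst (y <_) (trans (+-comm (c * a) c) (sym (*-suc c a))) y<ca+c

  comb-≤1 : ∀ a n y → comb a n y ≤ 1
  comb-≤1 a zero    y = z≤n
  comb-≤1 a (suc n) y with y ≟ c * a
  ... | yes refl = ≤-reflexive (comb-first a n)
  ... | no  y≢ca =
    subst (λ d → d + comb (suc a) n y ≤ 1) (sym (δ-off (≢-sym y≢ca))) (comb-≤1 (suc a) n y)

  spacedSum : (ℕ → ℕ) → ℕ → ℕ
  spacedSum w zero    = 0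
  spacedSum w (suc k) = spacedSum w k + w (c * k)

  comb-value : ∀ w a n M → a + n ≤ M →
    spacedSum w a + sumUpTo (λ y → comb a n y * w y) (c * M) ≡ spacedSum w (a + n)
  comb-value w a zero M _ = begin
    spacedSum w a + sumUpTo (λ _ → 0) (c * M) ≡⟨ cong (spacedSum w a +_) (sumUpTo-zero (c * M)) ⟩
    spacedSum w a + 0                         ≡⟨ +-identityʳ _ ⟩
    spacedSum w a                             ≡⟨ cong (spacedSum w) (+-identityʳ a) ⟨
    spacedSum w (a + 0)                       ∎
  comb-value w a (suc n) M le = begin
    spacedSum w a + sumUpTo (λ y → comb a (suc n) y * w y) (c * M)
      ≡⟨ cong (spacedSum w a +_) (trans
           (sumUpTo-cong (λ y → *-distribʳ-+ (w y) (δ (c * a) y) (comb (suc a) n y)) (c * M))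
           (sumUpTo-+ (λ y → δ (c * a) y * w y) rest (c * M))) ⟩
    spacedSum w a + (sumUpTo (λ y → δ (c * a) y * w y) (c * M) + sumUpTo rest (c * M))
      ≡⟨ cong (λ d → spacedSum w a + (d + sumUpTo rest (c * M)))
              (sumUpTo-δ w (c * a) (c * M) (*-monoʳ-< c a<M)) ⟩
    spacedSum w a + (w (c * a) + sumUpTo rest (c * M))
      ≡⟨ +-assoc (spacedSum w a) (w (c * a)) _ ⟨
    spacedSum w (suc a) + sumUpTo rest (c * M)
      ≡⟨ comb-value w (suc a) n M le′ ⟩
    spacedSum w (suc a + n)
      ≡⟨ cong (spacedSum w) (+-suc a n) ⟨
    spacedSum w (a + suc n) ∎
    where
    rest : ℕ → ℕ
    rest y = comb (suc a) n y * w y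
    le′ : suc a + n ≤ M
    le′ = subst (_≤ M) (+-suc a n) le
    a<M : a < M
    a<M = <-≤-trans (m<m+n a z<s) le

  comb-isRep : ∀ q → (∀ j → 2 ≤ q (suc j)) → ∀ a n →
    IsRep q (comb a n) (sumUpTo (λ y → comb a n y * Qprod q y) (c * (a + n)))
  comb-isRep q 2≤q a n =
    (λ y → <-≤-trans (s≤s (comb-≤1 a n y)) (2≤q y)) , c * (a + n) , comb-above a n , refl

Qprod-pos : ∀ q → (∀ j → 1 ≤ q j) → ∀ y → 1 ≤ Qprod q y
Qprod-pos q 1≤q zero    = 1≤q 0
Qprod-pos q 1≤q (suc y) = *-mono-≤ (Qprod-pos q 1≤q y) (1≤q (suc y))

same-residue⇒∣ : ∀ m g d .{{_ : NonZero d}} → m % d ≡ (m + g) % d → d ∣ g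
same-residue⇒∣ m g d same =
  ∣m+n∣m⇒∣n (divides ((m + g) / d) shifted) (n∣m*n (m / d))
  where
  shifted : m / d * d + g ≡ (m + g) / d * d
  shifted = +-cancelˡ-≡ (m % d) _ _ (begin
    m % d + (m / d * d + g)       ≡⟨ +-assoc (m % d) _ g ⟨
    m % d + m / d * d + g         ≡⟨ cong (_+ g) (m≡m%n+[m/n]*n m d) ⟨
    m + g                         ≡⟨ m≡m%n+[m/n]*n (m + g) d ⟩
    (m + g) % d + (m + g) / d * d ≡⟨ cong (_+ (m + g) / d * d) same ⟨
    m % d + (m + g) / d * d       ∎)

repeated-residue : ∀ (f : ℕ → ℕ) d .{{_ : NonZero d}} →
  ∃[ a ] ∃[ k ] (f a % d ≡ f (a + suc k) % d)
repeated-residue f d = collide (pigeonhole (n<1+n d) residue)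
  where
  residue : Fin (suc d) → Fin d
  residue i = fromℕ< (m%n<n (f (toℕ i)) d)

  collide : ∃[ i ] ∃[ j ] (toℕ i < toℕ j × residue i ≡ residue j) →
            ∃[ a ] ∃[ k ] (f a % d ≡ f (a + suc k) % d)
  collide (i , j , i<j , same) with m≤n⇒∃[o]m+o≡n i<j
  ... | k , 1+i+k≡j = toℕ i , k , (begin
    f (toℕ i) % d         ≡⟨ toℕ-fromℕ< _ ⟨
    toℕ (residue i)       ≡⟨ cong toℕ same ⟩
    toℕ (residue j)       ≡⟨ toℕ-fromℕ< _ ⟩
    f (toℕ j) % d         ≡⟨ cong (λ b → f b % d) (trans (+-suc (toℕ i) k) 1+i+k≡j) ⟨
    f (toℕ i + suc k) % d ∎)

lemma5p3 : (q : ℕ → ℕ) → q 0 ≡ 1 → (∀ j → 2 ≤ q (suc j)) →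
           (l : ℕ) → 1 ≤ l → (t : ℕ) →
           ∃[ x ] (1 ≤ x × ∃[ s ] (IsRep q s (x * l) ×
             ∃[ ymin ] ((∀ y → y < ymin → s y ≡ 0) × s ymin ≡ 1 ×
               (∀ y → ymin < y → y < ymin + t → s y ≡ 0))))
lemma5p3 q q0 2≤q l 1≤l t
  with repeated-residue (Comb.spacedSum (suc t) (Qprod q)) l {{>-nonZero 1≤l}}
... | a , k , same-residue =
  x , 1≤x , comb a n , isRep , c * a , comb-below a n , comb-first a k , gap
  where
  instance
    l≢0 : NonZero l
    l≢0 = >-nonZero 1≤l

  c : ℕ
  c = suc t
  open Comb c

  n : ℕ
  n = suc k

  g : ℕ
  g = sumUpTo (λ y → comb a n y * Qprod q y) (c * (a + n))

  l∣g : l ∣ g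
  l∣g = same-residue⇒∣ (spacedSum (Qprod q) a) g l
          (trans same-residue (cong (_% l) (sym (comb-value (Qprod q) a n (a + n) ≤-refl))))

  x : ℕ
  x = quotient l∣g

  isRep : IsRep q (comb a n) (x * l)
  isRep = subst (IsRep q (comb a n)) (m∣n⇒n≡quotient*m l∣g) (comb-isRep q 2≤q a n)

  radix-pos : ∀ j → 1 ≤ q j
  radix-pos zero    = ≤-reflexive (sym q0)
  radix-pos (suc j) = ≤-trans (n≤1+n 1) (2≤q j)

  1≤g : 1 ≤ g
  1≤g = ≤-trans (Qprod-pos q radix-pos (c * a))
          (subst (_≤ g) (trans (cong (_* Qprod q (c * a)) (comb-first a k)) (*-identityˡ _))
                 (term≤sumUpTo (λ y → comb a n y * Qprod q y) (*-monoʳ-< c (m<m+n a z<s))))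

  1≤x : 1 ≤ x
  1≤x = >-nonZero⁻¹ x {{quotient≢0 l∣g {{>-nonZero 1≤g}}}}

  gap : ∀ y → c * a < y → y < c * a + t → comb a n y ≡ 0
  gap y ca<y y<ca+t = comb-gap a k y ca<y (<-trans y<ca+t (+-monoʳ-< (c * a) (n<1+n t)))
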